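{- Let $L\ge1$ be an integer, $\varepsilon>0$, $k=\lceil L/\varepsilon\rceil$, and $q\in\{2,\dots,L\}$. Let $I^{\mathrm{old}}$ be a Max Weight Nullary 2CSP instance with Gaifman graph $G^{\mathrm{old}}$, and let $V_0,\dots,V_{k-1}$ be obtained by choosing a root $s_C$ in each connected component $C$ of $G^{\mathrm{old}}$ and letting $V_i$ be the set of vertices $v$ with $\mathsf{dist}_{G^{\mathrm{old}}}(s_C,v)\equiv i\pmod k$, where $C$ is the component of $v$. Let $I^{\mathrm{cur}}$ be a Max Weight Nullary 2CSP instance with $V(I^{\mathrm{cur}})\supseteq V(G^{\mathrm{old}})$, and for each $i$ let $I^{\mathrm{cur}}_i=I^{\mathrm{cur}}\setminus V_i$. Let $\mathsf{OPT}_i$ be the optimum revenue of $I^{\mathrm{cur}}_i$, and let $p_i$ satisfy $(1-\varepsilon\frac{q-1}{L})\mathsf{OPT}_i\le p_i\le\mathsf{OPT}_i$. Let $p=\max(p_0,\dots,p_{k-1})$. Then $(1-\varepsilon\frac{q}{L})\mathsf{OPT}\le p\le\mathsf{OPT}$, where $\mathsf{OPT}$ is the optimum revenue of $I^{\mathrm{cur}}$.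
   Context: An instance $I=(G,D,\mathsf{rev},C)$ of Max Weight Nullary 2CSP consists of a simple graph $G$ (Gaifman graph); for each vertex $u$ a finite domain $D_u$ containing $0$ and a revenue function $\mathsf{rev}_u:D_u\to\mathbb{R}_{\ge0}$ with $\mathsf{rev}_u(0)=0$; for each edge $uv$ a constraint $C_{uv}\subseteq D_u\times D_v$ containing $\{0\}\times D_v$ and $D_u\times\{0\}$. A solution is $\phi$ with $\phi(u)\in D_u$ and $(\phi(u),\phi(v))\in C_{uv}$ for each edge; its revenue is $\sum_u\mathsf{rev}_u(\phi(u))$; the optimum revenue is the maximum over solutions. For $Y\subseteq V(G)$, $I\setminus Y$ is obtained by deleting the vertices of $Y$ and all constraints incident to them.
   Formalization: The revenues $\mathsf{rev}_u$ take values in the nonnegative rationals instead of $\mathbb{R}_{\ge0}$, and the parameter ε and the numbers $p_i$ are rational. -}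

module Defs where

open import Data.Nat using (ℕ; zero; suc; _≤_)
open import Data.Fin using (Fin; zero; suc)
open import Data.Product using (Σ; _×_; _,_; ∃; proj₁; proj₂)
open import Relation.Nullary using (¬_)
open import Relation.Binary.PropositionalEquality using (_≡_)
open import Data.Rational as ℚ using (ℚ; 0ℚ)

-- Vertices live in a fixed finite universe Fin N; an instance has a vertex
-- set given by the predicate 'vert'. The domain of u is D_u = Fin (suc (dom u)),
-- whose element 'zero' plays the role of the value 0.
record Instance (N : ℕ) : Set₁ where
  field
    vert       : Fin N → Set
    adj        : Fin N → Fin N → Set
    adj-sym    : ∀ {u v} → adj u v → adj v u
    adj-irrefl : ∀ {u} → ¬ adj u u
    adj-vert   : ∀ {u v} → adj u v → vert u × vert v
    dom        : Fin N → ℕ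
    rev        : (u : Fin N) → Fin (suc (dom u)) → ℚ
    rev-nonneg : ∀ u a → 0ℚ ℚ.≤ rev u a
    rev-zero   : ∀ u → rev u zero ≡ 0ℚ
    con        : (u v : Fin N) → Fin (suc (dom u)) → Fin (suc (dom v)) → Set
    con-zeroˡ  : ∀ u v b → con u v zero b
    con-zeroʳ  : ∀ u v a → con u v a zero
    con-sym    : ∀ u v a b → con u v a b → con v u b a

open Instance public

Σℚ : {n : ℕ} → (Fin n → ℚ) → ℚ
Σℚ {zero}  f = 0ℚ
Σℚ {suc n} f = f zero ℚ.+ Σℚ (λ i → f (suc i))

-- A solution: an assignment (set to 0 outside the vertex set, so that it is
-- just an assignment on V(I)) satisfying every constraint of every edge.
record Solution {N : ℕ} (I : Instance N) : Set where
  field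
    φ      : (u : Fin N) → Fin (suc (dom I u))
    φ-out  : ∀ u → ¬ vert I u → φ u ≡ zero
    φ-cons : ∀ u v → adj I u v → con I u v (φ u) (φ v)

open Solution public

revenue : {N : ℕ} {I : Instance N} → Solution I → ℚ
revenue {I = I} s = Σℚ (λ u → rev I u (φ s u))

IsOpt : {N : ℕ} → Instance N → ℚ → Set
IsOpt I r = (Σ (Solution I) λ s → revenue s ≡ r) × (∀ (s : Solution I) → revenue s ℚ.≤ r)

_∖_ : {N : ℕ} → Instance N → (Fin N → Set) → Instance N
I ∖ Y = record
  { vert       = λ u → vert I u × ¬ Y u
  ; adj        = λ u v → adj I u v × ¬ Y u × ¬ Y v
  ; adj-sym    = λ { (e , yu , yv) → adj-sym I e , yv , yu }
  ; adj-irrefl = λ { (e , _ , _) → adj-irrefl I e }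
  ; adj-vert   = λ { (e , yu , yv) → (proj₁ (adj-vert I e) , yu) , (proj₂ (adj-vert I e) , yv) }
  ; dom        = dom I
  ; rev        = rev I
  ; rev-nonneg = rev-nonneg I
  ; rev-zero   = rev-zero I
  ; con        = con I
  ; con-zeroˡ  = con-zeroˡ I
  ; con-zeroʳ  = con-zeroʳ I
  ; con-sym    = con-sym I
  }

data Walk {N : ℕ} (I : Instance N) : Fin N → Fin N → ℕ → Set where
  nil  : ∀ {u} → vert I u → Walk I u u 0
  cons : ∀ {u w v d} → adj I u w → Walk I w v d → Walk I u v (suc d)

Connected : {N : ℕ} → Instance N → Fin N → Fin N → Set
Connected I u v = ∃ λ d → Walk I u v d

IsDist : {N : ℕ} → Instance N → Fin N → Fin N → ℕ → Set
IsDist I s v d = Walk I s v d × (∀ d' → Walk I s v d' → d ≤ d')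

IsMax : {k : ℕ} → (Fin k → ℚ) → ℚ → Set
IsMax {k} p m = (∃ λ (i : Fin k) → p i ≡ m) × (∀ i → p i ℚ.≤ m)

{-# OPTIONS --safe #-}

-- The layers V_i are pairwise disjoint, since the distance from a root is
-- unique.  Hence the revenue that an optimal solution of I^cur collects on
-- the k layers adds up to at most OPT, and some layer V_i carries at most
-- OPT/k ≤ ε·OPT/L of it.  Clearing that layer leaves a solution of I^cur_i,
-- so OPT_i ≥ (1 - ε/L)·OPT and p ≥ p_i ≥ (1 - ε(q-1)/L)·OPT_i ≥ (1 - εq/L)·OPT.
-- Conversely every solution of I^cur_i is a solution of I^cur, so p ≤ OPT.
-- Membership in a layer is not decidable constructively; but the lower bound
-- is a decidable inequality of rationals, so it may be proved under a double
-- negation, where decidability of the layers can be assumed.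
module Submission where

open import Defs
open import Data.Nat using (ℕ; _≤_; _∸_; _%_; NonZero)
open import Data.Fin using (Fin; toℕ)
open import Data.Integer using (+_)
open import Data.Product using (Σ; _×_; ∃)
open import Relation.Binary.PropositionalEquality using (_≡_)
open import Data.Rational using (ℚ; 0ℚ; 1ℚ; _<_; _/_; _÷_; _*_; _-_; ceiling; >-nonZero)
import Data.Rational as Q

open import Data.List.Base using (_∷_; [])
open import Data.Nat as ℕ using (zero; suc; s≤s)
import Data.Nat.Properties as ℕP
open import Data.Fin using (zero; suc; _≟_)
import Data.Fin.Properties as FinP
import Data.Integer as ℤ
import Data.Integer.Properties as ℤP
open import Data.Integer.DivMod using ([n/d]*d≤n)
import Data.Integer.Tactic.RingSolver as ℤ-Solver
open import Data.Rational using (_+_; -_; 1/_; ↥_; ↧_; floor; toℚᵘ)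
import Data.Rational.Properties as QP
open import Data.Rational.Unnormalised as ℚᵘ using (mkℚᵘ; *≡*; *≤*)
import Data.Rational.Unnormalised.Properties as ℚᵘP
open import Data.Product using (_,_; proj₁; proj₂)
open import Data.Sum using (inj₁; inj₂)
open import Function using (_∘_)
open import Relation.Nullary using (¬_; Dec; yes; no)
open import Relation.Nullary.Negation using (¬¬-map; contradiction)
open import Relation.Nullary.Decidable using (decidable-stable; ¬¬-excluded-middle; dec⇒maybe)
open import Relation.Binary.PropositionalEquality
  using (refl; sym; trans; cong; cong₂; subst; subst₂; _≢_; _≗_; module ≡-Reasoning)
open import Algebra.Properties.CommutativeMonoid.Sum QP.+-0-commutativeMonoid
  using (sum; sum-cong-≗; ∑-distrib-+; ∑-comm)
open import Tactic.RingSolver using (solve)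
import Tactic.RingSolver.Core.AlmostCommutativeRing as ACR

ℚ-ring : ACR.AlmostCommutativeRing _ _
ℚ-ring = ACR.fromCommutativeRing QP.+-*-commutativeRing (λ x → dec⇒maybe (0ℚ QP.≟ x))

toℚᵘ-/ : ∀ i n .{{_ : NonZero n}} → toℚᵘ (i / n) ℚᵘ.≃ i ℚᵘ./ n
toℚᵘ-/ i (suc m) = QP.toℚᵘ-fromℚᵘ (mkℚᵘ i m)

+-distrib-/ : ∀ m n d .{{_ : NonZero d}} → + (m ℕ.+ n) / d ≡ + m / d + + n / d
+-distrib-/ m n d@(suc _) = QP.toℚᵘ-injective (begin
    toℚᵘ (+ (m ℕ.+ n) / d)              ≈⟨ toℚᵘ-/ (+ (m ℕ.+ n)) d ⟩
    + (m ℕ.+ n) ℚᵘ./ d                  ≈⟨ *≡* (trans (cong (ℤ._* (+ d ℤ.* + d)) (ℤP.pos-+ m n))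
                                                      (distrib (+ m) (+ n) (+ d))) ⟩
    + m ℚᵘ./ d ℚᵘ.+ + n ℚᵘ./ d          ≈⟨ ℚᵘP.+-cong (toℚᵘ-/ (+ m) d) (toℚᵘ-/ (+ n) d) ⟨
    toℚᵘ (+ m / d) ℚᵘ.+ toℚᵘ (+ n / d)  ≈⟨ QP.toℚᵘ-homo-+ (+ m / d) (+ n / d) ⟨
    toℚᵘ (+ m / d + + n / d)            ∎)
  where
  open ℚᵘP.≃-Reasoning
  distrib : ∀ a b d → (a ℤ.+ b) ℤ.* (d ℤ.* d) ≡ (a ℤ.* d ℤ.+ b ℤ.* d) ℤ.* d
  distrib = ℤ-Solver.solve-∀

[1/n]*[n/1]≡1 : ∀ n .{{_ : NonZero n}} → (+ 1 / n) * (+ n / 1) ≡ 1ℚ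
[1/n]*[n/1]≡1 n@(suc _) = QP.toℚᵘ-injective (begin
    toℚᵘ ((+ 1 / n) * (+ n / 1))         ≈⟨ QP.toℚᵘ-homo-* (+ 1 / n) (+ n / 1) ⟩
    toℚᵘ (+ 1 / n) ℚᵘ.* toℚᵘ (+ n / 1)  ≈⟨ ℚᵘP.*-cong (toℚᵘ-/ (+ 1) n) (toℚᵘ-/ (+ n) 1) ⟩
    (+ 1 ℚᵘ./ n) ℚᵘ.* (+ n ℚᵘ./ 1)      ≈⟨ *≡* (cancel (+ n)) ⟩
    ℚᵘ.1ℚᵘ                              ∎)
  where
  open ℚᵘP.≃-Reasoning
  cancel : ∀ a → (+ 1 ℤ.* a) ℤ.* + 1 ≡ + 1 ℤ.* (a ℤ.* + 1)
  cancel = ℤ-Solver.solve-∀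

0≤n/d : ∀ n d .{{_ : NonZero d}} → 0ℚ Q.≤ + n / d
0≤n/d n d = QP.nonNegative⁻¹ (+ n / d) {{QP.normalize-nonNeg n d}}

⌊p⌋*↧p≤↥p : ∀ p → floor p ℤ.* ↧ p ℤ.≤ ↥ p
⌊p⌋*↧p≤↥p (Q.mkℚ n d-1 _) = [n/d]*d≤n n (+ suc d-1)

↥p≤⌈p⌉*↧p : ∀ p → ↥ p ℤ.≤ ceiling p ℤ.* ↧ p
↥p≤⌈p⌉*↧p p@record{} = subst₂ ℤ._≤_ (ℤP.neg-involutive (↥ p)) (ℤP.neg-distribˡ-* (floor (- p)) (↧ p))
  (ℤP.neg-mono-≤ (subst₂ (λ d n → floor (- p) ℤ.* d ℤ.≤ n) (QP.↧-neg p) (QP.↥-neg p) (⌊p⌋*↧p≤↥p (- p))))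

p≤⌈p⌉ : ∀ p → p Q.≤ ceiling p / 1
p≤⌈p⌉ p@record{} = QP.toℚᵘ-cancel-≤ (ℚᵘP.≤-respʳ-≃ (ℚᵘP.≃-sym (toℚᵘ-/ (ceiling p) 1))
  (*≤* (subst (ℤ._≤ ceiling p ℤ.* ↧ p) (sym (ℤP.*-identityʳ (↥ p))) (↥p≤⌈p⌉*↧p p))))

x≤⌈x÷ε⌉*ε : ∀ x ε (ε>0 : 0ℚ < ε) → x Q.≤ (ceiling (_÷_ x ε {{>-nonZero ε>0}}) / 1) * ε
x≤⌈x÷ε⌉*ε x ε ε>0 = begin
  x                         ≡⟨ QP.*-identityʳ x ⟨
  x * 1ℚ                    ≡⟨ cong (x *_) (QP.*-inverseˡ ε) ⟨
  x * (1/ ε * ε)            ≡⟨ QP.*-assoc x (1/ ε) ε ⟨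
  (x ÷ ε) * ε               ≤⟨ QP.*-monoʳ-≤-nonNeg ε {{QP.pos⇒nonNeg ε {{Q.positive ε>0}}}} (p≤⌈p⌉ (x ÷ ε)) ⟩
  (ceiling (x ÷ ε) / 1) * ε ∎
  where
  open QP.≤-Reasoning
  instance
    ε≢0 : Q.NonZero ε
    ε≢0 = >-nonZero ε>0

p≤q⇒0≤q-p : ∀ {p q} → p Q.≤ q → 0ℚ Q.≤ q - p
p≤q⇒0≤q-p {p} {q} p≤q = subst (Q._≤ q - p) (QP.+-inverseʳ p) (QP.+-monoˡ-≤ (- p) p≤q)

0≤q⇒p-q≤p : ∀ {p q} → 0ℚ Q.≤ q → p - q Q.≤ p
0≤q⇒p-q≤p {p} {q} 0≤q = subst (p - q Q.≤_) (QP.+-identityʳ p) (QP.+-monoʳ-≤ p (QP.neg-antimono-≤ 0≤q))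

p≤q+r⇒p-q≤r : ∀ {p q r} → p Q.≤ q + r → p - q Q.≤ r
p≤q+r⇒p-q≤r {p} {q} {r} p≤q+r = begin
  p - q       ≤⟨ QP.+-monoˡ-≤ (- q) p≤q+r ⟩
  q + r - q   ≡⟨ solve (q ∷ r ∷ []) ℚ-ring ⟩
  r           ∎
  where open QP.≤-Reasoning

≤-fraction : ∀ {ε w L k x X} → 0ℚ Q.≤ ε → 0ℚ Q.≤ w → w * L ≡ 1ℚ → L Q.≤ k * ε →
             0ℚ Q.≤ x → k * x Q.≤ X → x Q.≤ ε * w * X
≤-fraction {ε} {w} {L} {k} {x} {X} 0≤ε 0≤w wL≡1 L≤kε 0≤x kx≤X = begin
  x                  ≡⟨ QP.*-identityˡ x ⟨
  1ℚ * x             ≡⟨ cong (_* x) wL≡1 ⟨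
  w * L * x          ≡⟨ QP.*-assoc w L x ⟩
  w * (L * x)        ≤⟨ QP.*-monoˡ-≤-nonNeg w (QP.*-monoʳ-≤-nonNeg x L≤kε) ⟩
  w * (k * ε * x)    ≡⟨ cong (w *_) (solve (k ∷ ε ∷ x ∷ []) ℚ-ring) ⟩
  w * (ε * (k * x))  ≤⟨ QP.*-monoˡ-≤-nonNeg w (QP.*-monoˡ-≤-nonNeg ε kx≤X) ⟩
  w * (ε * X)        ≡⟨ solve (w ∷ ε ∷ X ∷ []) ℚ-ring ⟩
  ε * w * X          ∎
  where
  open QP.≤-Reasoning
  instance
    ε≥0 : Q.NonNegative ε
    ε≥0 = Q.nonNegative 0≤ε
    w≥0 : Q.NonNegative w
    w≥0 = Q.nonNegative 0≤w
    x≥0 : Q.NonNegative x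
    x≥0 = Q.nonNegative 0≤x

approximation-≤ : ∀ {c δ O OPT p} → 0ℚ Q.≤ c → O Q.≤ OPT → OPT - O Q.≤ δ * OPT →
                  (1ℚ - c) * O Q.≤ p → (1ℚ - (c + δ)) * OPT Q.≤ p
approximation-≤ {c} {δ} {O} {OPT} {p} 0≤c O≤OPT loss≤δOPT cO≤p = begin
  (1ℚ - (c + δ)) * OPT             ≡⟨ solve (c ∷ δ ∷ OPT ∷ []) ℚ-ring ⟩
  (1ℚ - c) * OPT - δ * OPT         ≤⟨ QP.+-monoʳ-≤ ((1ℚ - c) * OPT) (QP.neg-antimono-≤ loss≤δOPT) ⟩
  (1ℚ - c) * OPT - (OPT - O)       ≡⟨ solve (c ∷ OPT ∷ O ∷ []) ℚ-ring ⟩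
  (1ℚ - c) * O - c * (OPT - O)     ≤⟨ 0≤q⇒p-q≤p (QP.nonNegative⁻¹ (c * (OPT - O))) ⟩
  (1ℚ - c) * O                     ≤⟨ cO≤p ⟩
  p                                ∎
  where
  open QP.≤-Reasoning
  instance
    c≥0 : Q.NonNegative c
    c≥0 = Q.nonNegative 0≤c
    loss≥0 : Q.NonNegative (OPT - O)
    loss≥0 = Q.nonNegative (p≤q⇒0≤q-p O≤OPT)
    c*loss≥0 : Q.NonNegative (c * (OPT - O))
    c*loss≥0 = QP.nonNeg*nonNeg⇒nonNeg c (OPT - O)

layer-approximation-≤ : ∀ {L} .{{_ : NonZero L}} {ε k q O OPT p} → 0ℚ Q.≤ ε → + L / 1 Q.≤ k * ε →
  O Q.≤ OPT → k * (OPT - O) Q.≤ OPT → (1ℚ - ε * (+ q / L)) * O Q.≤ p → (1ℚ - ε * (+ suc q / L)) * OPT Q.≤ p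
layer-approximation-≤ {L} {ε} {k} {q} {O} {OPT} {p} 0≤ε L≤kε O≤OPT k[OPT-O]≤OPT approx = begin
  (1ℚ - ε * (+ suc q / L)) * OPT  ≡⟨ cong (λ a → (1ℚ - a) * OPT) ε[1+q]/L≡εq/L+ε/L ⟩
  (1ℚ - (ε * b + ε * w)) * OPT    ≤⟨ approximation-≤ 0≤εb O≤OPT loss≤εwOPT approx ⟩
  p                               ∎
  where
  open QP.≤-Reasoning
  b w : ℚ
  b = + q / L
  w = + 1 / L
  ε[1+q]/L≡εq/L+ε/L : ε * (+ suc q / L) ≡ ε * b + ε * w
  ε[1+q]/L≡εq/L+ε/L = trans (cong (ε *_) (trans (+-distrib-/ 1 q L) (QP.+-comm w b))) (QP.*-distribˡ-+ ε b w)
  0≤εb : 0ℚ Q.≤ ε * b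
  0≤εb = QP.nonNegative⁻¹ (ε * b)
    {{QP.nonNeg*nonNeg⇒nonNeg ε {{Q.nonNegative 0≤ε}} b {{QP.normalize-nonNeg q L}}}}
  loss≤εwOPT : OPT - O Q.≤ ε * w * OPT
  loss≤εwOPT = ≤-fraction {k = k} 0≤ε (0≤n/d 1 L) ([1/n]*[n/1]≡1 L) L≤kε (p≤q⇒0≤q-p O≤OPT) k[OPT-O]≤OPT

Σℚ≡sum : ∀ {n} (f : Fin n → ℚ) → Σℚ f ≡ sum f
Σℚ≡sum {zero}  f = refl
Σℚ≡sum {suc n} f = cong (_+_ (f zero)) (Σℚ≡sum (f ∘ suc))

Σℚ-cong : ∀ {n} {f g : Fin n → ℚ} → f ≗ g → Σℚ f ≡ Σℚ g
Σℚ-cong {f = f} {g} f≗g = trans (Σℚ≡sum f) (trans (sum-cong-≗ f≗g) (sym (Σℚ≡sum g)))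

Σℚ-distrib-+ : ∀ {n} (f g : Fin n → ℚ) → Σℚ (λ i → f i + g i) ≡ Σℚ f + Σℚ g
Σℚ-distrib-+ f g = begin
  Σℚ (λ i → f i + g i)  ≡⟨ Σℚ≡sum (λ i → f i + g i) ⟩
  sum (λ i → f i + g i) ≡⟨ ∑-distrib-+ f g ⟩
  sum f + sum g         ≡⟨ cong₂ _+_ (Σℚ≡sum f) (Σℚ≡sum g) ⟨
  Σℚ f + Σℚ g           ∎
  where open ≡-Reasoning

Σℚ-comm : ∀ {m n} (f : Fin m → Fin n → ℚ) → Σℚ (λ i → Σℚ (f i)) ≡ Σℚ (λ j → Σℚ (λ i → f i j))
Σℚ-comm f = begin
  Σℚ (λ i → Σℚ (f i))            ≡⟨ Σℚ≡sum (λ i → Σℚ (f i)) ⟩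
  sum (λ i → Σℚ (f i))           ≡⟨ sum-cong-≗ (Σℚ≡sum ∘ f) ⟩
  sum (λ i → sum (f i))          ≡⟨ ∑-comm f ⟩
  sum (λ j → sum (λ i → f i j))  ≡⟨ sum-cong-≗ (λ j → Σℚ≡sum (λ i → f i j)) ⟨
  sum (λ j → Σℚ (λ i → f i j))   ≡⟨ Σℚ≡sum (λ j → Σℚ (λ i → f i j)) ⟨
  Σℚ (λ j → Σℚ (λ i → f i j))    ∎
  where open ≡-Reasoning

Σℚ-mono-≤ : ∀ {n} {f g : Fin n → ℚ} → (∀ i → f i Q.≤ g i) → Σℚ f Q.≤ Σℚ g
Σℚ-mono-≤ {zero}  _   = QP.≤-refl
Σℚ-mono-≤ {suc n} f≤g = QP.+-mono-≤ (f≤g zero) (Σℚ-mono-≤ (f≤g ∘ suc))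

Σℚ-const : ∀ n c → Σℚ {n} (λ _ → c) ≡ (+ n / 1) * c
Σℚ-const zero    c = sym (QP.*-zeroˡ c)
Σℚ-const (suc n) c = begin
  c + Σℚ {n} (λ _ → c)  ≡⟨ cong (_+_ c) (Σℚ-const n c) ⟩
  c + (+ n / 1) * c     ≡⟨ cong (_+ (+ n / 1) * c) (QP.*-identityˡ c) ⟨
  1ℚ * c + (+ n / 1) * c ≡⟨ QP.*-distribʳ-+ c 1ℚ (+ n / 1) ⟨
  (1ℚ + + n / 1) * c    ≡⟨ cong (_* c) (+-distrib-/ 1 n 1) ⟨
  (+ suc n / 1) * c     ∎
  where open ≡-Reasoning

argmin : ∀ {n} (f : Fin (suc n) → ℚ) → ∃ λ i → ∀ j → f i Q.≤ f j
argmin {zero}  f = zero , λ { zero → QP.≤-refl }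
argmin {suc n} f with argmin (f ∘ suc)
... | i , min with QP.≤-total (f zero) (f (suc i))
...   | inj₁ f₀≤fᵢ = zero  , λ { zero → QP.≤-refl ; (suc j) → QP.≤-trans f₀≤fᵢ (min j) }
...   | inj₂ fᵢ≤f₀ = suc i , λ { zero → fᵢ≤f₀     ; (suc j) → min j }

∃-≤-average : ∀ {n} .{{_ : NonZero n}} (f : Fin n → ℚ) → ∃ λ i → (+ n / 1) * f i Q.≤ Σℚ f
∃-≤-average {suc n} f = let i , min = argmin f in
  i , subst (Q._≤ Σℚ f) (Σℚ-const (suc n) (f i)) (Σℚ-mono-≤ min)

indicator : ∀ {P : Set} → Dec P → ℚ → ℚ
indicator (yes _) r = r
indicator (no _)  _ = 0ℚ

Σℚ-indicator-≡0 : ∀ {n} {P : Fin n → Set} (P? : ∀ i → Dec (P i)) {r} →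
                  (∀ i → ¬ P i) → Σℚ (λ i → indicator (P? i) r) ≡ 0ℚ
Σℚ-indicator-≡0 {zero}  _  _  = refl
Σℚ-indicator-≡0 {suc n} P? ¬P with P? zero
... | yes P₀ = contradiction P₀ (¬P zero)
... | no _   = cong (_+_ 0ℚ) (Σℚ-indicator-≡0 (P? ∘ suc) (¬P ∘ suc))

Σℚ-indicator-≤ : ∀ {n} {P : Fin n → Set} (P? : ∀ i → Dec (P i)) {r} →
                 (∀ {i j} → P i → P j → i ≡ j) → 0ℚ Q.≤ r → Σℚ (λ i → indicator (P? i) r) Q.≤ r
Σℚ-indicator-≤ {zero}  _  _      0≤r = 0≤r
Σℚ-indicator-≤ {suc n} {P} P? {r} unique 0≤r with P? zero
... | yes P₀ = QP.≤-reflexive (trans (cong (_+_ r) (Σℚ-indicator-≡0 (P? ∘ suc) ¬P∘suc)) (QP.+-identityʳ r))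
  where
  ¬P∘suc : ∀ i → ¬ P (suc i)
  ¬P∘suc i P₁₊ᵢ with () ← unique P₀ P₁₊ᵢ
... | no _   = subst (Q._≤ r) (sym (QP.+-identityˡ _))
                 (Σℚ-indicator-≤ (P? ∘ suc) (λ Pᵢ Pⱼ → FinP.suc-injective (unique Pᵢ Pⱼ)) 0≤r)

clear : ∀ {m} {P : Set} → Dec P → Fin (suc m) → Fin (suc m)
clear (yes _) _ = zero
clear (no _)  a = a

module _ {N : ℕ} (I : Instance N) (Y : Fin N → Set) where

  extend : Solution (I ∖ Y) → Solution I
  extend s = record { φ = φ s ; φ-out = λ u ∉I → φ-out s u (∉I ∘ proj₁) ; φ-cons = φ-cons′ }
    where
    ≢0⇒∉Y : ∀ u → φ s u ≢ zero → ¬ Y u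
    ≢0⇒∉Y u φu≢0 Yu = φu≢0 (φ-out s u (λ (_ , ∉Y) → ∉Y Yu))
    φ-cons′ : ∀ u v → adj I u v → con I u v (φ s u) (φ s v)
    φ-cons′ u v uv with φ s u ≟ zero | φ s v ≟ zero
    ... | yes φu≡0 | _        rewrite φu≡0 = con-zeroˡ I u v (φ s v)
    ... | no _     | yes φv≡0 rewrite φv≡0 = con-zeroʳ I u v (φ s u)
    ... | no φu≢0  | no φv≢0  = φ-cons s u v (uv , ≢0⇒∉Y u φu≢0 , ≢0⇒∉Y v φv≢0)

  ∖-optimum-≤ : ∀ {o OPT} → IsOpt (I ∖ Y) o → IsOpt I OPT → o Q.≤ OPT
  ∖-optimum-≤ ((s , revenue≡o) , _) (_ , optimal) = subst (Q._≤ _) revenue≡o (optimal (extend s))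

  module _ (Y? : ∀ u → Dec (Y u)) where

    restrict : Solution I → Solution (I ∖ Y)
    restrict s = record { φ = φ′ ; φ-out = φ-out′ ; φ-cons = φ-cons′ }
      where
      φ′ : ∀ u → Fin (suc (dom I u))
      φ′ u = clear (Y? u) (φ s u)
      φ-out′ : ∀ u → ¬ (vert I u × ¬ Y u) → φ′ u ≡ zero
      φ-out′ u ∉I∖Y with Y? u
      ... | yes _  = refl
      ... | no ∉Y  = φ-out s u (λ ∈I → ∉I∖Y (∈I , ∉Y))
      φ-cons′ : ∀ u v → adj (I ∖ Y) u v → con I u v (φ′ u) (φ′ v)
      φ-cons′ u v (uv , ∉Yu , ∉Yv) with Y? u | Y? v
      ... | yes Yu | _      = contradiction Yu ∉Yu
      ... | no _   | yes Yv = contradiction Yv ∉Yv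
      ... | no _   | no _   = φ-cons s u v uv

    removedRevenue : Solution I → ℚ
    removedRevenue s = Σℚ (λ u → indicator (Y? u) (rev I u (φ s u)))

    revenue-restrict : ∀ s → revenue (restrict s) + removedRevenue s ≡ revenue s
    revenue-restrict s = trans (sym (Σℚ-distrib-+ kept removed)) (Σℚ-cong split)
      where
      kept removed : Fin N → ℚ
      kept    u = rev I u (clear (Y? u) (φ s u))
      removed u = indicator (Y? u) (rev I u (φ s u))
      split : ∀ u → kept u + removed u ≡ rev I u (φ s u)
      split u with Y? u
      ... | yes _ = trans (cong (_+ rev I u (φ s u)) (rev-zero I u)) (QP.+-identityˡ _)
      ... | no _  = QP.+-identityʳ _

    revenue-∖-optimum-≤ : ∀ {O} s → IsOpt (I ∖ Y) O → revenue s - O Q.≤ removedRevenue s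
    revenue-∖-optimum-≤ {O} s (_ , optimal) = p≤q+r⇒p-q≤r (begin
      revenue s                             ≡⟨ revenue-restrict s ⟨
      revenue (restrict s) + removedRevenue s ≤⟨ QP.+-monoˡ-≤ (removedRevenue s) (optimal (restrict s)) ⟩
      O + removedRevenue s                  ∎)
      where open QP.≤-Reasoning

module _ {N k : ℕ} .{{_ : NonZero k}} (I : Instance N) (Y : Fin k → Fin N → Set)
         (Y? : ∀ i u → Dec (Y i u)) (disjoint : ∀ {i j u} → Y i u → Y j u → i ≡ j) where

  removedRevenues : Solution I → Fin k → ℚ
  removedRevenues s i = removedRevenue I (Y i) (Y? i) s

  Σℚ-removedRevenues-≤ : ∀ s → Σℚ (removedRevenues s) Q.≤ revenue s
  Σℚ-removedRevenues-≤ s = begin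
    Σℚ (λ i → Σℚ (λ u → removed i u))  ≡⟨ Σℚ-comm removed ⟩
    Σℚ (λ u → Σℚ (λ i → removed i u))  ≤⟨ Σℚ-mono-≤ removed-≤ ⟩
    Σℚ r                               ∎
    where
    open QP.≤-Reasoning
    r : Fin N → ℚ
    r u = rev I u (φ s u)
    removed : Fin k → Fin N → ℚ
    removed i u = indicator (Y? i u) (r u)
    removed-≤ : ∀ u → Σℚ (λ i → removed i u) Q.≤ r u
    removed-≤ u = Σℚ-indicator-≤ (λ i → Y? i u) disjoint (rev-nonneg I u (φ s u))

  ∃-deletion-loss-≤ : ∀ {OPT} {OPTs : Fin k → ℚ} → IsOpt I OPT → (∀ i → IsOpt (I ∖ Y i) (OPTs i)) →
                      ∃ λ i → (+ k / 1) * (OPT - OPTs i) Q.≤ OPT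
  ∃-deletion-loss-≤ {OPTs = OPTs} ((s , refl) , _) OPTs-opt with ∃-≤-average (removedRevenues s)
  ... | i , k*removedᵢ≤Σ = i , (begin
    (+ k / 1) * (revenue s - OPTs i) ≤⟨ QP.*-monoˡ-≤-nonNeg (+ k / 1) {{QP.normalize-nonNeg k 1}}
                                          (revenue-∖-optimum-≤ I (Y i) (Y? i) s (OPTs-opt i)) ⟩
    (+ k / 1) * removedRevenues s i  ≤⟨ k*removedᵢ≤Σ ⟩
    Σℚ (removedRevenues s)           ≤⟨ Σℚ-removedRevenues-≤ s ⟩
    revenue s                        ∎)
    where open QP.≤-Reasoning

IsDist-unique : ∀ {N} {I : Instance N} {s v d d′} → IsDist I s v d → IsDist I s v d′ → d ≡ d′
IsDist-unique (walk , shortest) (walk′ , shortest′) = ℕP.≤-antisym (shortest _ walk′) (shortest′ _ walk)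

Layer : ∀ {N} → Instance N → (Fin N → Fin N) → (k : ℕ) .{{_ : NonZero k}} → Fin k → Fin N → Set
Layer I root k i v = vert I v × ∃ λ d → IsDist I (root v) v d × d % k ≡ toℕ i

Layer-disjoint : ∀ {N} {I : Instance N} {root k} .{{_ : NonZero k}} {i j v} →
                 Layer I root k i v → Layer I root k j v → i ≡ j
Layer-disjoint {k = k} {i} {j} (_ , d , dist , d%k≡i) (_ , d′ , dist′ , d′%k≡j) = FinP.toℕ-injective (begin
  toℕ i   ≡⟨ d%k≡i ⟨
  d % k   ≡⟨ cong (_% k) (IsDist-unique dist dist′) ⟩
  d′ % k  ≡⟨ d′%k≡j ⟩
  toℕ j   ∎)
  where open ≡-Reasoning

¬¬-Π : ∀ n {P : Fin n → Set} → (∀ i → ¬ ¬ P i) → ¬ ¬ (∀ i → P i)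
¬¬-Π zero    _   ¬∀ = ¬∀ (λ ())
¬¬-Π (suc n) ¬¬P ¬∀ = ¬¬P zero (λ P₀ → ¬¬-Π n (¬¬P ∘ suc) (λ P₁₊ → ¬∀ (λ { zero → P₀ ; (suc i) → P₁₊ i })))

¬¬-decidable₂ : ∀ {m n} (P : Fin m → Fin n → Set) → ¬ ¬ (∀ i u → Dec (P i u))
¬¬-decidable₂ {m} {n} _ = ¬¬-Π m (λ _ → ¬¬-Π n (λ _ → ¬¬-excluded-middle))

lemma18 : (L : ℕ) .{{_ : NonZero L}} (ε : ℚ) (ε>0 : 0ℚ < ε)
    (k : ℕ) .{{_ : NonZero k}} → + k ≡ ceiling (_÷_ (+ L / 1) ε {{>-nonZero ε>0}})
    → (q : ℕ) → 2 ≤ q → q ≤ L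
    → (N : ℕ) (Iold : Instance N)
    → (root : Fin N → Fin N)
    → (∀ v → vert Iold v → Connected Iold (root v) v)
    → (∀ u v → Connected Iold u v → root u ≡ root v)
    → (Icur : Instance N)
    → (∀ v → vert Iold v → vert Icur v)
    → (OPTi : Fin k → ℚ)
    → (∀ (i : Fin k) → IsOpt (Icur ∖ (λ v → vert Iold v × ∃ λ d → IsDist Iold (root v) v d × d % k ≡ toℕ i)) (OPTi i))
    → (p : Fin k → ℚ)
    → (∀ i → (1ℚ - ε * (+ (q ∸ 1) / L)) * OPTi i Q.≤ p i × p i Q.≤ OPTi i)
    → (pmax : ℚ) → IsMax p pmax
    → (OPT : ℚ) → IsOpt Icur OPT
    → (1ℚ - ε * (+ q / L)) * OPT Q.≤ pmax × pmax Q.≤ OPT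
lemma18 L ε ε>0 k k≡⌈L/ε⌉ q@(suc q′) (s≤s _) _ N Iold root _ _ Icur _ OPTs OPTs-opt p p≈OPTs
        pmax (pmax∈p , p≤pmax) OPT OPT-opt = lower-bound , upper-bound
  where
  Y : Fin k → Fin N → Set
  Y = Layer Iold root k

  OPTs≤OPT : ∀ i → OPTs i Q.≤ OPT
  OPTs≤OPT i = ∖-optimum-≤ Icur (Y i) (OPTs-opt i) OPT-opt

  upper-bound : pmax Q.≤ OPT
  upper-bound = let i , pᵢ≡pmax = pmax∈p in
    subst (Q._≤ OPT) pᵢ≡pmax (QP.≤-trans (proj₂ (p≈OPTs i)) (OPTs≤OPT i))

  L≤kε : + L / 1 Q.≤ (+ k / 1) * ε
  L≤kε = subst (λ c → + L / 1 Q.≤ (c / 1) * ε) (sym k≡⌈L/ε⌉) (x≤⌈x÷ε⌉*ε (+ L / 1) ε ε>0)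

  bound : (∀ i u → Dec (Y i u)) → (1ℚ - ε * (+ q / L)) * OPT Q.≤ pmax
  bound Y? =
    let i , k[OPT-OPTᵢ]≤OPT = ∃-deletion-loss-≤ Icur Y Y? (Layer-disjoint {root = root}) OPT-opt OPTs-opt
    in QP.≤-trans (layer-approximation-≤ {k = + k / 1} (QP.<⇒≤ ε>0) L≤kε (OPTs≤OPT i) k[OPT-OPTᵢ]≤OPT
                                         (proj₁ (p≈OPTs i)))
                  (p≤pmax i)

  lower-bound : (1ℚ - ε * (+ q / L)) * OPT Q.≤ pmax
  lower-bound = decidable-stable (_ QP.≤? pmax) (¬¬-map bound (¬¬-decidable₂ Y))
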